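{- Let $n\ge 2$ be an integer. If $A=\begin{pmatrix}0&0\\0&1\end{pmatrix}$, then all of $(K_{n+2}\oplus_{=} K_{n+2})^{n+1}_A$, $(K_{n+2}\oplus_{=} \overline{K_{n+2}})^{n+1}_A$, $(K_{n+2}\oplus_{\neq} K_{n+2})^{n+1}_A$, and $(K_{n+2}\oplus_{\neq} \overline{K_{n+2}})^{n+1}_A$ have vertex-minors isomorphic to $nT_{2,n}$.
   Context: $\overline{K_m}$ is the edgeless graph on $m$ vertices; $T_{2,n}$ is the $1$-subdivision of the star $K_{1,n}$; $nT_{2,n}$ is the disjoint union of $n$ copies of it. For two $m$-vertex graphs $G,H$ on disjoint vertex sets with orderings $v_1,\dots,v_m$ and $w_1,\dots,w_m$, $G\oplus_{=}H$ (resp. $G\oplus_{\neq}H$) is the graph on $V(G)\cup V(H)$ inducing $G$ on $V(G)$ and $H$ on $V(H)$, in which $v_iw_j$ is an edge iff $i=j$ (resp. iff $i\neq j$). For $\odot\in\{\oplus_=,\oplus_{\neq}\}$, a positive integer $s$ and a $0$-$1$ matrix $A=\begin{pmatrix}a&b\\c&d\end{pmatrix}$, $(G\odot H)^s_A$ is the disjoint union of $s$ copies of $G\odot H$ with added edges such that for all $1\le i<j\le s$, the $i$-th copy of $G$ is complete (if $a=1$) or anti-complete (if $a=0$) to the $j$-th copy of $G$; likewise with $b$ for ($i$-th $G$, $j$-th $H$), $c$ for ($i$-th $H$, $j$-th $G$), and $d$ for ($i$-th $H$, $j$-th $H$). A vertex-minor of $G$ is an induced subgraph of a graph obtained from $G$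 by a sequence of local complementations, where local complementation at $v$ replaces the subgraph induced on $N_G(v)$ by its complement. -}

module Defs where

open import Data.Bool using (Bool; true; false; not; _∧_; _xor_)
open import Data.Bool.Properties using (∧-comm; ∧-zeroʳ)
open import Data.Nat using (ℕ; suc; _+_)
open import Data.Fin using (Fin; _<_)
import Data.Fin.Properties as FinP
open import Data.Unit using (⊤; tt)
open import Data.Empty using (⊥-elim)
open import Data.Sum using (_⊎_; inj₁; inj₂)
import Data.Sum.Properties as SumP
open import Data.Product using (_×_; _,_; ∃-syntax)
import Data.Product.Properties as ProdP
open import Data.List using (List; []; _∷_)
open import Relation.Binary.Definitions using (DecidableEquality; tri<; tri≈; tri>)
open import Relation.Nullary.Decidable using (⌊_⌋; yes; no)
open import Relation.Binary.PropositionalEquality using (_≡_; refl; sym; trans; cong; cong₂)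
open import Function.Definitions using (Injective)

record SimpleGraph (V : Set) : Set where
  field
    E     : V → V → Bool
    E-sym : ∀ x y → E x y ≡ E y x
    E-irr : ∀ x → E x x ≡ false
open SimpleGraph public

eqb : {A : Set} → DecidableEquality A → A → A → Bool
eqb d x y = ⌊ d x y ⌋

eqb-sym : {A : Set} (d : DecidableEquality A) (x y : A) → eqb d x y ≡ eqb d y x
eqb-sym d x y with d x y | d y x
... | yes _ | yes _ = refl
... | no  _ | no  _ = refl
... | yes p | no q = ⊥-elim (q (sym p))
... | no q | yes p = ⊥-elim (q (sym p))

eqb-refl : {A : Set} (d : DecidableEquality A) (x : A) → eqb d x x ≡ true
eqb-refl d x with d x x
... | yes _ = refl
... | no q = ⊥-elim (q refl)

lcE : {V : Set} → DecidableEquality V → (V → V → Bool) → V → (V → V → Bool)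
lcE d E v x y = E x y xor (E v x ∧ (E v y ∧ not (eqb d x y)))

lcSeq : {V : Set} → DecidableEquality V → (V → V → Bool) → List V → (V → V → Bool)
lcSeq d E []       = E
lcSeq d E (v ∷ vs) = lcSeq d (lcE d E v) vs

HasVertexMinorIsoTo : {W V : Set} → DecidableEquality W →
                      SimpleGraph W → SimpleGraph V → Set
HasVertexMinorIsoTo {W} {V} d G H =
  ∃[ vs ] ∃[ f ] (Injective _≡_ _≡_ f ×
                  (∀ (x y : V) → E H x y ≡ lcSeq d (E G) vs (f x) (f y)))

K : (m : ℕ) → SimpleGraph (Fin m)
K m = record
  { E = λ i j → not (eqb FinP._≟_ i j)
  ; E-sym = λ i j → cong not (eqb-sym FinP._≟_ i j)
  ; E-irr = λ i → cong not (eqb-refl FinP._≟_ i) }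

coK : (m : ℕ) → SimpleGraph (Fin m)
coK m = record { E = λ _ _ → false ; E-sym = λ _ _ → refl ; E-irr = λ _ → refl }

-- G ⊕₌ H and G ⊕≠ H, vertices v_i = inj₁ i (of G) and w_j = inj₂ j (of H)

data JoinType : Set where
  ⊕₌ ⊕≠ : JoinType

cross : JoinType → {m : ℕ} → Fin m → Fin m → Bool
cross ⊕₌ i j = eqb FinP._≟_ i j
cross ⊕≠ i j = not (eqb FinP._≟_ i j)

cross-sym : (t : JoinType) {m : ℕ} (i j : Fin m) → cross t i j ≡ cross t j i
cross-sym ⊕₌ i j = eqb-sym FinP._≟_ i j
cross-sym ⊕≠ i j = cong not (eqb-sym FinP._≟_ i j)

joinE : JoinType → {m : ℕ} → SimpleGraph (Fin m) → SimpleGraph (Fin m) →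
        Fin m ⊎ Fin m → Fin m ⊎ Fin m → Bool
joinE t G H (inj₁ i) (inj₁ j) = E G i j
joinE t G H (inj₂ i) (inj₂ j) = E H i j
joinE t G H (inj₁ i) (inj₂ j) = cross t i j
joinE t G H (inj₂ i) (inj₁ j) = cross t j i

joinE-sym : (t : JoinType) {m : ℕ} (G H : SimpleGraph (Fin m)) (x y : Fin m ⊎ Fin m) →
            joinE t G H x y ≡ joinE t G H y x
joinE-sym t G H (inj₁ i) (inj₁ j) = E-sym G i j
joinE-sym t G H (inj₂ i) (inj₂ j) = E-sym H i j
joinE-sym t G H (inj₁ i) (inj₂ j) = refl
joinE-sym t G H (inj₂ i) (inj₁ j) = refl

joinE-irr : (t : JoinType) {m : ℕ} (G H : SimpleGraph (Fin m)) (x : Fin m ⊎ Fin m) →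
            joinE t G H x x ≡ false
joinE-irr t G H (inj₁ i) = E-irr G i
joinE-irr t G H (inj₂ i) = E-irr H i

-- (G ⊙ H)^s_A : vertices (k , x) with k : Fin s the copy index

record Mat2 : Set where
  constructor mat
  field a b c d : Bool

entry : {m : ℕ} → Mat2 → Fin m ⊎ Fin m → Fin m ⊎ Fin m → Bool
entry (mat a b c d) (inj₁ _) (inj₁ _) = a
entry (mat a b c d) (inj₁ _) (inj₂ _) = b
entry (mat a b c d) (inj₂ _) (inj₁ _) = c
entry (mat a b c d) (inj₂ _) (inj₂ _) = d

A0001 : Mat2
A0001 = mat false false false true

PowV : ℕ → ℕ → Set
PowV s m = Fin s × (Fin m ⊎ Fin m)

PowV-dec : (s m : ℕ) → DecidableEquality (PowV s m)
PowV-dec s m = ProdP.≡-dec FinP._≟_ (SumP.≡-dec FinP._≟_ FinP._≟_)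

powE : JoinType → {m : ℕ} → SimpleGraph (Fin m) → SimpleGraph (Fin m) →
       (s : ℕ) → Mat2 → PowV s m → PowV s m → Bool
powE t G H s A (i , x) (j , y) with FinP.<-cmp i j
... | tri< _ _ _ = entry A x y
... | tri≈ _ _ _ = joinE t G H x y
... | tri> _ _ _ = entry A y x

powE-sym : (t : JoinType) {m : ℕ} (G H : SimpleGraph (Fin m)) (s : ℕ) (A : Mat2)
           (p q : PowV s m) → powE t G H s A p q ≡ powE t G H s A q p
powE-sym t G H s A (i , x) (j , y) with FinP.<-cmp i j | FinP.<-cmp j i
... | tri< _ _ _ | tri> _ _ _ = refl
... | tri> _ _ _ | tri< _ _ _ = refl
... | tri≈ _ _ _ | tri≈ _ _ _ = joinE-sym t G H x y
... | tri< p _ _ | tri< q _ _ = ⊥-elim (FinP.<-asym p q)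
... | tri< _ e _ | tri≈ _ e' _ = ⊥-elim (e (sym e'))
... | tri≈ _ e _ | tri< _ e' _ = ⊥-elim (e' (sym e))
... | tri≈ _ e _ | tri> _ e' _ = ⊥-elim (e' (sym e))
... | tri> _ _ p | tri> _ _ q = ⊥-elim (FinP.<-asym p q)
... | tri> _ e _ | tri≈ _ e' _ = ⊥-elim (e (sym e'))

powE-irr : (t : JoinType) {m : ℕ} (G H : SimpleGraph (Fin m)) (s : ℕ) (A : Mat2)
           (p : PowV s m) → powE t G H s A p p ≡ false
powE-irr t G H s A (i , x) with FinP.<-cmp i i
... | tri< p _ _ = ⊥-elim (FinP.<-irrefl refl p)
... | tri≈ _ _ _ = joinE-irr t G H x
... | tri> _ _ p = ⊥-elim (FinP.<-irrefl refl p)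

Pow : JoinType → {m : ℕ} → SimpleGraph (Fin m) → SimpleGraph (Fin m) →
      (s : ℕ) → Mat2 → SimpleGraph (PowV s m)
Pow t G H s A = record
  { E = powE t G H s A ; E-sym = powE-sym t G H s A ; E-irr = powE-irr t G H s A }

-- T_{2,n}: the 1-subdivision of the star K_{1,n}.
-- Vertices: centre inj₁ tt; for each i : Fin n the subdivision vertex
-- inj₂ (i , false) and the leaf inj₂ (i , true).

TV : ℕ → Set
TV n = ⊤ ⊎ (Fin n × Bool)

TE : {n : ℕ} → TV n → TV n → Bool
TE (inj₁ _) (inj₁ _) = false
TE (inj₁ _) (inj₂ (i , false)) = true
TE (inj₁ _) (inj₂ (i , true)) = false
TE (inj₂ (i , false)) (inj₁ _) = true
TE (inj₂ (i , true)) (inj₁ _) = false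
TE (inj₂ (i , false)) (inj₂ (j , false)) = false
TE (inj₂ (i , false)) (inj₂ (j , true)) = eqb FinP._≟_ i j
TE (inj₂ (i , true)) (inj₂ (j , false)) = eqb FinP._≟_ i j
TE (inj₂ (i , true)) (inj₂ (j , true)) = false

TE-sym : {n : ℕ} (x y : TV n) → TE x y ≡ TE y x
TE-sym (inj₁ _) (inj₁ _) = refl
TE-sym (inj₁ _) (inj₂ (i , false)) = refl
TE-sym (inj₁ _) (inj₂ (i , true)) = refl
TE-sym (inj₂ (i , false)) (inj₁ _) = refl
TE-sym (inj₂ (i , true)) (inj₁ _) = refl
TE-sym (inj₂ (i , false)) (inj₂ (j , false)) = refl
TE-sym (inj₂ (i , false)) (inj₂ (j , true)) = eqb-sym FinP._≟_ i j
TE-sym (inj₂ (i , true)) (inj₂ (j , false)) = eqb-sym FinP._≟_ i j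
TE-sym (inj₂ (i , true)) (inj₂ (j , true)) = refl

TE-irr : {n : ℕ} (x : TV n) → TE x x ≡ false
TE-irr (inj₁ _) = refl
TE-irr (inj₂ (i , false)) = refl
TE-irr (inj₂ (i , true)) = refl

T2 : (n : ℕ) → SimpleGraph (TV n)
T2 n = record { E = TE ; E-sym = TE-sym ; E-irr = TE-irr }

nT2 : (n : ℕ) → SimpleGraph (Fin n × TV n)
nT2 n = record
  { E = λ { (c , x) (d , y) → eqb FinP._≟_ c d ∧ TE x y }
  ; E-sym = λ { (c , x) (d , y) → cong₂ _∧_ (eqb-sym FinP._≟_ c d) (TE-sym x y) }
  ; E-irr = λ { (c , x) → trans (cong (eqb FinP._≟_ c c ∧_) (TE-irr x)) (∧-zeroʳ _) } }

-- A local complementation at v only changes edges inside N(v). In (G ⊙ H)^{n+1}_A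
-- distinct copies are joined exactly between their H-parts, so local complementations at
-- G-vertices act inside their own copy, and complementing N(apex) for an H-vertex apex of
-- the last copy complements the H-part of each of the other n copies and deletes all edges
-- between them. So it suffices to turn one copy of G ⊙ H into a graph containing T_{2,n}
-- by pivots in G, then complementing H, then further pivots (PowerGraph.vertexMinor);
-- doing this in the copies 0, ..., n-1 gives n T_{2,n}.
-- The local constructions are verified by restriction: local complementation commutes
-- with restriction along injective maps, and any two vertices of T_{2,n} lie in a copy of
-- T_{2,2} spanned by two branches, so evaluating the case n = 2 suffices. For K ⊕≠ K̄ the
-- construction also needs the n pairwise non-adjacent pivots v_0, ..., v_{n-1}, whose
-- effect is summed explicitly.

module Submission where

open import Defs
open import Data.Nat using (ℕ; _≤_; _+_; s≤s; z≤n)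
open import Data.Bool using (Bool; true; false; not; _∧_; _xor_)
import Data.Bool.Properties as Bool
open import Data.Bool.Properties
  using (∧-identityʳ; ∧-zeroʳ; xor-identityʳ; xor-assoc; xor-comm; xor-same)
open import Data.Fin using (Fin; zero; suc; _↑ˡ_; _↑ʳ_; splitAt)
import Data.Fin.Properties as FinP
open import Data.Fin.Properties using (_≟_)
open import Data.Sum using (_⊎_; inj₁; inj₂)
import Data.Sum as Sum
import Data.Sum.Properties as SumP
open import Data.Product using (_×_; _,_; proj₁; proj₂; ∃-syntax; map₁; uncurry)
open import Data.Unit using (tt)
open import Data.Empty using (⊥)
open import Data.List using (List; []; _∷_; _++_; map; foldr; tabulate)
open import Data.List.Properties using (map-tabulate; tabulate-cong)
open import Data.List.Relation.Unary.All using (All; []; _∷_; all?)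
import Data.List.Relation.Unary.All as All
open import Data.List.Relation.Unary.Any using (here; there)
open import Data.List.Membership.Propositional using (_∈_)
open import Data.List.Relation.Unary.All.Properties using (++⁺; tabulate⁺)
open import Relation.Binary.Definitions using (DecidableEquality; tri<; tri≈; tri>)
open import Relation.Binary.PropositionalEquality
  using (_≡_; _≢_; ≢-sym; refl; sym; trans; cong; cong₂; subst; module ≡-Reasoning)
open import Relation.Nullary using (Dec; yes; no; contradiction)
open import Relation.Nullary.Decidable using (True; toWitness)
open import Function.Definitions using (Injective)

private
  variable
    X Y : Set

eqb-≢ : (d : DecidableEquality X) {x y : X} → x ≢ y → eqb d x y ≡ false
eqb-≢ d {x} {y} x≢y with d x y
... | yes x≡y = contradiction x≡y x≢y
... | no _    = refl

eqb-injective : (dX : DecidableEquality X) (dY : DecidableEquality Y) {h : X → Y} →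
                Injective _≡_ _≡_ h → ∀ x y → eqb dY (h x) (h y) ≡ eqb dX x y
eqb-injective dX dY {h} inj x y with dX x y
... | yes refl = eqb-refl dY (h x)
... | no x≢y   = eqb-≢ dY (λ e → x≢y (inj e))

Adj : Set → Set
Adj V = V → V → Bool

clique : DecidableEquality X → (X → Bool) → Adj X
clique d S x y = S x ∧ (S y ∧ not (eqb d x y))

-- complement the edges inside S; local complementation at v is the
-- special case S = N(v), i.e. lcE d E v = complementOn d (E v) E
complementOn : DecidableEquality X → (X → Bool) → Adj X → Adj X
complementOn d S E x y = E x y xor clique d S x y

PullsBack : (X → Y) → Adj Y → Adj X → Set
PullsBack h E F = ∀ x y → E (h x) (h y) ≡ F x y

complementOn-pullback : (dX : DecidableEquality X) (dY : DecidableEquality Y)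
  {h : X → Y} {E : Adj Y} {F : Adj X} {S : Y → Bool} {S′ : X → Bool} →
  Injective _≡_ _≡_ h → PullsBack h E F → (∀ x → S (h x) ≡ S′ x) →
  PullsBack h (complementOn dY S E) (complementOn dX S′ F)
complementOn-pullback dX dY inj E≈F S≈S′ x y =
  cong₂ _xor_ (E≈F x y)
    (cong₂ _∧_ (S≈S′ x) (cong₂ _∧_ (S≈S′ y) (cong not (eqb-injective dX dY inj x y))))

lcSeq-pullback : (dX : DecidableEquality X) (dY : DecidableEquality Y)
  {h : X → Y} {E : Adj Y} {F : Adj X} → Injective _≡_ _≡_ h → PullsBack h E F →
  (vs : List X) → PullsBack h (lcSeq dY E (map h vs)) (lcSeq dX F vs)
lcSeq-pullback dX dY inj E≈F []       = E≈F
lcSeq-pullback dX dY {h} {E} inj E≈F (v ∷ vs) =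
  lcSeq-pullback dX dY inj (complementOn-pullback dX dY {E = E} {S = E (h v)} inj E≈F (E≈F v)) vs

lcSeq-++ : (d : DecidableEquality X) (E : Adj X) (us vs : List X) →
           lcSeq d E (us ++ vs) ≡ lcSeq d (lcSeq d E us) vs
lcSeq-++ d E []       vs = refl
lcSeq-++ d E (u ∷ us) vs = lcSeq-++ d (lcE d E u) us vs

lcE-nonneighbour : (d : DecidableEquality X) (E : Adj X) {v u : X} → E v u ≡ false →
                   ∀ w → lcE d E v u w ≡ E u w × lcE d E v w u ≡ E w u
lcE-nonneighbour d E {v} {u} vu w
  rewrite vu | ∧-zeroʳ (E v w) = xor-identityʳ (E u w) , xor-identityʳ (E w u)

Independent : Adj X → (X → Set) → Set
Independent E S = ∀ {u w} → S u → S w → E u w ≡ false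

flips : DecidableEquality X → Adj X → List X → Adj X
flips d E vs x y = foldr _xor_ false (map (λ v → clique d (E v) x y) vs)

-- pivots in an independent set do not change each other's neighbourhoods,
-- so their local complementations add up
lcSeq-independent : (d : DecidableEquality X) {E : Adj X} {S : X → Set} → Independent E S →
  {vs : List X} → All S vs → ∀ x y → lcSeq d E vs x y ≡ E x y xor flips d E vs x y
lcSeq-independent d ind [] x y = sym (xor-identityʳ _)
lcSeq-independent d {E} {S} ind {v ∷ vs} (sv ∷ svs) x y = begin
  lcSeq d (lcE d E v) vs x y                               ≡⟨ lcSeq-independent d ind′ svs x y ⟩
  lcE d E v x y xor flips d (lcE d E v) vs x y             ≡⟨ cong (lcE d E v x y xor_) (unchanged svs) ⟩
  (E x y xor clique d (E v) x y) xor flips d E vs x y      ≡⟨ xor-assoc (E x y) _ _ ⟩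
  E x y xor flips d E (v ∷ vs) x y                         ∎
  where
  open ≡-Reasoning
  row : ∀ {u} → S u → ∀ w → lcE d E v u w ≡ E u w
  row su w = proj₁ (lcE-nonneighbour d E (ind sv su) w)
  ind′ : Independent (lcE d E v) S
  ind′ su sw = trans (row su _) (ind su sw)
  unchanged : ∀ {us} → All S us → flips d (lcE d E v) us x y ≡ flips d E us x y
  unchanged []         = refl
  unchanged (su ∷ sus) =
    cong₂ _xor_ (cong₂ _∧_ (row su x) (cong₂ _∧_ (row su y) refl)) (unchanged sus)

xorSum : {k : ℕ} → (Fin k → Bool) → Bool
xorSum f = foldr _xor_ false (tabulate f)

xorSum-false : {k : ℕ} (f : Fin k → Bool) → (∀ c → f c ≡ false) → xorSum f ≡ false
xorSum-false {ℕ.zero}  f zeros = refl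
xorSum-false {ℕ.suc k} f zeros rewrite zeros zero = xorSum-false (λ c → f (suc c)) (λ c → zeros (suc c))

xorSum-single : {k : ℕ} (f : Fin k → Bool) (i : Fin k) →
                (∀ c → c ≢ i → f c ≡ false) → xorSum f ≡ f i
xorSum-single f zero    others
  rewrite xorSum-false (λ c → f (suc c)) (λ c → others (suc c) (λ ())) = xor-identityʳ (f zero)
xorSum-single f (suc i) others
  rewrite others zero (λ ()) =
  xorSum-single (λ c → f (suc c)) i (λ c c≢i → others (suc c) (λ e → c≢i (FinP.suc-injective e)))

pivotsAt : {k : ℕ} → Fin k → List (Fin k × X) → List X
pivotsAt c []              = []
pivotsAt c ((c′ , v) ∷ ps) with c′ ≟ c
... | yes _ = v ∷ pivotsAt c ps
... | no  _ = pivotsAt c ps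

rounds : {k : ℕ} → List X → List (Fin k × X)
rounds []       = []
rounds (v ∷ vs) = tabulate (λ c → c , v) ++ rounds vs

rounds-All : {k : ℕ} {P : X → Set} {vs : List X} → All P vs →
             All (λ p → P (proj₂ p)) (rounds {k = k} vs)
rounds-All []         = []
rounds-All (pv ∷ pvs) = ++⁺ (tabulate⁺ (λ _ → pv)) (rounds-All pvs)

pivotsAt-++ : {k : ℕ} (c : Fin k) (ps qs : List (Fin k × X)) →
              pivotsAt c (ps ++ qs) ≡ pivotsAt c ps ++ pivotsAt c qs
pivotsAt-++ c []              qs = refl
pivotsAt-++ c ((c′ , v) ∷ ps) qs with c′ ≟ c
... | yes _ = cong (v ∷_) (pivotsAt-++ c ps qs)
... | no  _ = pivotsAt-++ c ps qs

pivotsAt-shift : {k : ℕ} (c : Fin k) (ps : List (Fin k × X)) →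
                 pivotsAt (suc c) (map (map₁ suc) ps) ≡ pivotsAt c ps
pivotsAt-shift c []              = refl
pivotsAt-shift c ((c′ , v) ∷ ps) with c′ ≟ c
... | yes _ = cong (v ∷_) (pivotsAt-shift c ps)
... | no  _ = pivotsAt-shift c ps

pivotsAt-zero-shift : {k : ℕ} (ps : List (Fin k × X)) → pivotsAt zero (map (map₁ suc) ps) ≡ []
pivotsAt-zero-shift []       = refl
pivotsAt-zero-shift (_ ∷ ps) = pivotsAt-zero-shift ps

pivotsAt-round : {k : ℕ} (c : Fin k) (v : X) → pivotsAt c (tabulate (λ c′ → c′ , v)) ≡ v ∷ []
pivotsAt-round {k = ℕ.suc k} zero    v =
  cong (v ∷_) (trans (cong (pivotsAt zero) (sym (map-tabulate {n = k} (λ c′ → c′ , v) (map₁ suc))))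
                     (pivotsAt-zero-shift (tabulate {n = k} (λ c′ → c′ , v))))
pivotsAt-round {k = ℕ.suc k} (suc c) v =
  trans (cong (pivotsAt (suc c)) (sym (map-tabulate {n = k} (λ c′ → c′ , v) (map₁ suc))))
        (trans (pivotsAt-shift c (tabulate (λ c′ → c′ , v))) (pivotsAt-round c v))

pivotsAt-rounds : {k : ℕ} (c : Fin k) (vs : List X) → pivotsAt c (rounds vs) ≡ vs
pivotsAt-rounds c []       = refl
pivotsAt-rounds c (v ∷ vs) = trans (pivotsAt-++ c (tabulate (λ c′ → c′ , v)) (rounds vs))
  (cong₂ _++_ (pivotsAt-round c v) (pivotsAt-rounds c vs))

pattern centre = inj₁ tt
pattern sub  i = inj₂ (i , false)
pattern leaf i = inj₂ (i , true)

relabel : {k n : ℕ} → (Fin k → Fin n) → TV k → TV n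
relabel τ centre         = centre
relabel τ (inj₂ (i , β)) = inj₂ (τ i , β)

TE-relabel : {k n : ℕ} {τ : Fin k → Fin n} → Injective _≡_ _≡_ τ →
             ∀ x y → TE (relabel τ x) (relabel τ y) ≡ TE x y
TE-relabel inj centre   centre   = refl
TE-relabel inj centre   (sub j)  = refl
TE-relabel inj centre   (leaf j) = refl
TE-relabel inj (sub i)  centre   = refl
TE-relabel inj (leaf i) centre   = refl
TE-relabel inj (sub i)  (sub j)  = refl
TE-relabel inj (sub i)  (leaf j) = eqb-injective _≟_ _≟_ inj i j
TE-relabel inj (leaf i) (sub j)  = eqb-injective _≟_ _≟_ inj i j
TE-relabel inj (leaf i) (leaf j) = refl

pair : {n : ℕ} → Fin n → Fin n → Fin 2 → Fin n
pair i j zero       = i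
pair i j (suc zero) = j

pair-injective : {n : ℕ} {i j : Fin n} → i ≢ j → Injective _≡_ _≡_ (pair i j)
pair-injective i≢j {zero}     {zero}     _ = refl
pair-injective i≢j {zero}     {suc zero} e = contradiction e i≢j
pair-injective i≢j {suc zero} {zero}     e = contradiction (sym e) i≢j
pair-injective i≢j {suc zero} {suc zero} _ = refl

another : {n : ℕ} (i : Fin (ℕ.suc (ℕ.suc n))) → ∃[ j ] i ≢ j
another zero    = suc zero , λ ()
another (suc i) = zero , λ ()

pairCover : {n : ℕ} → 2 ≤ n → (P : TV n → TV n → Set) →
  (∀ i j → i ≢ j → ∀ x y → P (relabel (pair i j) x) (relabel (pair i j) y)) → ∀ x y → P x y
pairCover (s≤s (s≤s z≤n)) P inPair centre centre = inPair zero (suc zero) (λ ()) centre centre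
pairCover (s≤s (s≤s z≤n)) P inPair centre (inj₂ (k , β)) =
  inPair k (proj₁ (another k)) (proj₂ (another k)) centre (inj₂ (zero , β))
pairCover (s≤s (s≤s z≤n)) P inPair (inj₂ (k , β)) centre =
  inPair k (proj₁ (another k)) (proj₂ (another k)) (inj₂ (zero , β)) centre
pairCover (s≤s (s≤s z≤n)) P inPair (inj₂ (k , β)) (inj₂ (l , γ)) with k ≟ l
... | yes refl = inPair k (proj₁ (another k)) (proj₂ (another k)) (inj₂ (zero , β)) (inj₂ (zero , γ))
... | no  k≢l  = inPair k l k≢l (inj₂ (zero , β)) (inj₂ (suc zero , γ))

vertices₂ : List (TV 2)
vertices₂ = centre ∷ sub zero ∷ leaf zero ∷ sub (suc zero) ∷ leaf (suc zero) ∷ []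

listed : (x : TV 2) → x ∈ vertices₂
listed centre            = here refl
listed (sub zero)        = there (here refl)
listed (leaf zero)       = there (there (here refl))
listed (sub (suc zero))  = there (there (there (here refl)))
listed (leaf (suc zero)) = there (there (there (there (here refl))))

isT₂? : (R : TV 2 → TV 2 → Bool) →
        Dec (All (λ x → All (λ y → TE x y ≡ R x y) vertices₂) vertices₂)
isT₂? R = all? (λ x → all? (λ y → TE x y Bool.≟ R x y) vertices₂) vertices₂

byEvaluation : (R : TV 2 → TV 2 → Bool) → {True (isT₂? R)} → ∀ x y → TE x y ≡ R x y
byEvaluation R {ok} x y = All.lookup (All.lookup (toWitness ok) (listed x)) (listed y)

transfer : {n : ℕ} → 2 ≤ n → (Rₙ : TV n → TV n → Bool) (R₂ : TV 2 → TV 2 → Bool) →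
  (∀ i j → i ≢ j → ∀ x y → Rₙ (relabel (pair i j) x) (relabel (pair i j) y) ≡ R₂ x y) →
  (∀ x y → TE x y ≡ R₂ x y) → ∀ x y → TE x y ≡ Rₙ x y
transfer 2≤n Rₙ R₂ restricts isT₂ = pairCover 2≤n (λ x y → TE x y ≡ Rₙ x y)
  λ i j i≢j x y → trans (TE-relabel (pair-injective i≢j) x y)
                        (trans (isT₂ x y) (sym (restricts i j i≢j x y)))

Slot : ℕ → Set
Slot m = Fin m ⊎ Fin m

dSlot : (m : ℕ) → DecidableEquality (Slot m)
dSlot m = SumP.≡-dec _≟_ _≟_

isH : {m : ℕ} → Slot m → Bool
isH (inj₁ _) = false
isH (inj₂ _) = true

mapSlot : {k m : ℕ} → (Fin k → Fin m) → Slot k → Slot m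
mapSlot σ = Sum.map σ σ

mapSlot-injective : {k m : ℕ} {σ : Fin k → Fin m} →
                    Injective _≡_ _≡_ σ → Injective _≡_ _≡_ (mapSlot σ)
mapSlot-injective inj {inj₁ i} {inj₁ j} e = cong inj₁ (inj (SumP.inj₁-injective e))
mapSlot-injective inj {inj₂ i} {inj₂ j} e = cong inj₂ (inj (SumP.inj₂-injective e))

isH-map : {k m : ℕ} (σ : Fin k → Fin m) (x : Slot k) → isH (mapSlot σ x) ≡ isH x
isH-map σ (inj₁ _) = refl
isH-map σ (inj₂ _) = refl

-- graphs on Fin m defined through equality of vertices alone restrict along injections
EqualityDefined : ((m : ℕ) → SimpleGraph (Fin m)) → Set
EqualityDefined F =
  ∀ {k m} {σ : Fin k → Fin m} → Injective _≡_ _≡_ σ → PullsBack σ (E (F m)) (E (F k))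

K-equalityDefined : EqualityDefined K
K-equalityDefined inj i j = cong not (eqb-injective _≟_ _≟_ inj i j)

coK-equalityDefined : EqualityDefined coK
coK-equalityDefined inj i j = refl

cross-pullback : (t : JoinType) {k m : ℕ} {σ : Fin k → Fin m} → Injective _≡_ _≡_ σ →
                 PullsBack σ (cross t) (cross t)
cross-pullback ⊕₌ inj i j = eqb-injective _≟_ _≟_ inj i j
cross-pullback ⊕≠ inj i j = cong not (eqb-injective _≟_ _≟_ inj i j)

join-pullback : (t : JoinType) (F F′ : (m : ℕ) → SimpleGraph (Fin m)) →
  EqualityDefined F → EqualityDefined F′ →
  {k m : ℕ} {σ : Fin k → Fin m} → Injective _≡_ _≡_ σ →
  PullsBack (mapSlot σ) (joinE t (F m) (F′ m)) (joinE t (F k) (F′ k))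
join-pullback t F F′ eqF eqF′ inj (inj₁ i) (inj₁ j) = eqF inj i j
join-pullback t F F′ eqF eqF′ inj (inj₂ i) (inj₂ j) = eqF′ inj i j
join-pullback t F F′ eqF eqF′ inj (inj₁ i) (inj₂ j) = cross-pullback t inj i j
join-pullback t F F′ eqF eqF′ inj (inj₂ i) (inj₁ j) = cross-pullback t inj j i

-- The slots used to embed T_{2,n} in one copy, for G and H on n + 2 vertices:
-- the branch i uses v_i and w_i, the centre uses the spare vertex v_{n}

base : {n : ℕ} → Fin n → Fin (n + 2)
base i = i ↑ˡ 2

spare₁ spare₂ : {n : ℕ} → Fin (n + 2)
spare₁ {n} = n ↑ʳ zero
spare₂ {n} = n ↑ʳ suc zero

↑ˡ≢↑ʳ : {n k : ℕ} (i : Fin n) (j : Fin k) → i ↑ˡ k ≢ n ↑ʳ j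
↑ˡ≢↑ʳ {n} {k} i j e
  with trans (sym (FinP.splitAt-↑ˡ n i k)) (trans (cong (splitAt n) e) (FinP.splitAt-↑ʳ n k j))
... | ()

base-injective : {n : ℕ} → Injective _≡_ _≡_ (base {n})
base-injective = FinP.↑ˡ-injective 2 _ _

embed : {n : ℕ} → TV n → Slot (n + 2)
embed centre   = inj₁ spare₁
embed (sub i)  = inj₁ (base i)
embed (leaf i) = inj₂ (base i)

embed-injective : {n : ℕ} → Injective _≡_ _≡_ (embed {n})
embed-injective {x = centre}   {centre}   _ = refl
embed-injective {x = centre}   {sub j}    e = contradiction (sym (SumP.inj₁-injective e)) (↑ˡ≢↑ʳ j zero)
embed-injective {x = sub i}    {centre}   e = contradiction (SumP.inj₁-injective e) (↑ˡ≢↑ʳ i zero)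
embed-injective {x = sub i}    {sub j}    e = cong sub (base-injective (SumP.inj₁-injective e))
embed-injective {x = leaf i}   {leaf j}   e = cong leaf (base-injective (SumP.inj₂-injective e))
embed-injective {x = centre}   {leaf _}   ()
embed-injective {x = sub _}    {leaf _}   ()
embed-injective {x = leaf _}   {centre}   ()
embed-injective {x = leaf _}   {sub _}    ()

spread : {n : ℕ} → Fin n → Fin n → Fin 4 → Fin (n + 2)
spread     i j zero          = base i
spread     i j (suc zero)    = base j
spread {n} i j (suc (suc s)) = n ↑ʳ s

spread-injective : {n : ℕ} {i j : Fin n} → i ≢ j → Injective _≡_ _≡_ (spread i j)
spread-injective i≢j {zero}        {zero}        _ = refl
spread-injective i≢j {suc zero}    {suc zero}    _ = refl
spread-injective i≢j {zero}        {suc zero}    e = contradiction (base-injective e) i≢j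
spread-injective i≢j {suc zero}    {zero}        e = contradiction (base-injective (sym e)) i≢j
spread-injective i≢j {zero}        {suc (suc s)} e = contradiction e (↑ˡ≢↑ʳ _ s)
spread-injective i≢j {suc zero}    {suc (suc s)} e = contradiction e (↑ˡ≢↑ʳ _ s)
spread-injective i≢j {suc (suc s)} {zero}        e = contradiction (sym e) (↑ˡ≢↑ʳ _ s)
spread-injective i≢j {suc (suc s)} {suc zero}    e = contradiction (sym e) (↑ˡ≢↑ʳ _ s)
spread-injective {n} i≢j {suc (suc s)} {suc (suc s′)} e =
  cong (λ r → suc (suc r)) (FinP.↑ʳ-injective n s s′ e)

embed-relabel : {n : ℕ} (i j : Fin n) (x : TV 2) →
                embed (relabel (pair i j) x) ≡ mapSlot (spread i j) (embed x)
embed-relabel i j centre            = refl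
embed-relabel i j (sub zero)        = refl
embed-relabel i j (leaf zero)       = refl
embed-relabel i j (sub (suc zero))  = refl
embed-relabel i j (leaf (suc zero)) = refl

-- The copies 0, ..., n-1 carry the copies of T_{2,n}; the last
-- copy provides the apex, an H-vertex adjacent to the H-parts of all other copies.

module PowerGraph {n : ℕ} (t : JoinType) (G H : SimpleGraph (Fin (n + 2))) where

  V : Set
  V = PowV (n + 1) (n + 2)

  dV : DecidableEquality V
  dV = PowV-dec (n + 1) (n + 2)

  dL : DecidableEquality (Slot (n + 2))
  dL = dSlot (n + 2)

  joinedH : Adj (Slot (n + 2))
  joinedH x y = isH x ∧ isH y

  ι : Fin n → Slot (n + 2) → V
  ι c x = c ↑ˡ 1 , x

  ι-injective : (c : Fin n) → Injective _≡_ _≡_ (ι c)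
  ι-injective c e = cong proj₂ e

  ι-separates : {c d : Fin n} → c ≢ d → ∀ x y → ι c x ≢ ι d y
  ι-separates c≢d x y e = c≢d (FinP.↑ˡ-injective 1 _ _ (cong proj₁ e))

  apex : V
  apex = n ↑ʳ zero , inj₂ spare₁

  apex-separate : (c : Fin n) → n ↑ʳ zero ≢ c ↑ˡ 1
  apex-separate c e = ↑ˡ≢↑ʳ c zero (sym e)

  E₀ : Adj V
  E₀ = powE t G H (n + 1) A0001

  power-same : ∀ p x y → E₀ (p , x) (p , y) ≡ joinE t G H x y
  power-same p x y with FinP.<-cmp p p
  ... | tri< p<p _ _ = contradiction p<p (FinP.<-irrefl refl)
  ... | tri≈ _ _ _   = refl
  ... | tri> _ _ p>p = contradiction p>p (FinP.<-irrefl refl)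

  entry-A : ∀ x y → entry A0001 x y ≡ joinedH x y
  entry-A (inj₁ _) (inj₁ _) = refl
  entry-A (inj₁ _) (inj₂ _) = refl
  entry-A (inj₂ _) (inj₁ _) = refl
  entry-A (inj₂ _) (inj₂ _) = refl

  power-distinct : ∀ {p q} → p ≢ q → ∀ x y → E₀ (p , x) (q , y) ≡ joinedH x y
  power-distinct {p} {q} p≢q x y with FinP.<-cmp p q
  ... | tri< _ _ _   = entry-A x y
  ... | tri≈ _ p≡q _ = contradiction p≡q p≢q
  ... | tri> _ _ _   = trans (entry-A y x) (Bool.∧-comm (isH y) (isH x))

  record Blocks (E : Adj V) (L : Fin n → Adj (Slot (n + 2))) (X : Adj (Slot (n + 2))) : Set where
    field
      inside : ∀ c → PullsBack (ι c) E (L c)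
      across : ∀ {c d} → c ≢ d → ∀ x y → E (ι c x) (ι d y) ≡ X x y
  open Blocks

  blocks-cong : ∀ {E L L′ X} → (∀ c → L c ≡ L′ c) → Blocks E L X → Blocks E L′ X
  inside (blocks-cong L≡L′ B) c x y = trans (inside B c x y) (cong (λ F → F x y) (L≡L′ c))
  across (blocks-cong L≡L′ B)       = across B

  Isolated : Adj (Slot (n + 2)) → Slot (n + 2) → Set
  Isolated X v = ∀ y → X v y ≡ false

  blocks-step : ∀ {E L X} (c₀ : Fin n) {v} → Isolated X v → Blocks E L X →
    Blocks (lcE dV E (ι c₀ v)) (λ c → lcSeq dL (L c) (pivotsAt c ((c₀ , v) ∷ []))) X
  inside (blocks-step {E} c₀ {v} iso B) c x y with c₀ ≟ c
  ... | yes refl = complementOn-pullback dL dV {E = E} {S = E (ι c v)} (ι-injective c)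
                     (inside B c) (inside B c v) x y
  ... | no c₀≢c  = trans (proj₁ (lcE-nonneighbour dV E (trans (across B c₀≢c v x) (iso x)) (ι c y)))
                         (inside B c x y)
  across (blocks-step {E} c₀ {v} iso B) {c} {d} c≢d x y with c₀ ≟ c
  ... | yes refl = trans (proj₂ (lcE-nonneighbour dV E (trans (across B c≢d v y) (iso y)) (ι c x)))
                         (across B c≢d x y)
  ... | no c₀≢c  = trans (proj₁ (lcE-nonneighbour dV E (trans (across B c₀≢c v x) (iso x)) (ι d y)))
                         (across B c≢d x y)

  blocks-lcSeq : ∀ {E L X} (ps : List (Fin n × Slot (n + 2))) → All (λ p → Isolated X (proj₂ p)) ps →
    Blocks E L X → Blocks (lcSeq dV E (map (uncurry ι) ps)) (λ c → lcSeq dL (L c) (pivotsAt c ps)) X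
  blocks-lcSeq []              []           B = B
  blocks-lcSeq ((c₀ , v) ∷ ps) (iso ∷ isos) B =
    blocks-cong merge (blocks-lcSeq ps isos (blocks-step c₀ iso B))
    where
    merge : ∀ c → lcSeq dL (lcSeq dL _ (pivotsAt c ((c₀ , v) ∷ []))) (pivotsAt c ps)
                ≡ lcSeq dL _ (pivotsAt c ((c₀ , v) ∷ ps))
    merge c with c₀ ≟ c
    ... | yes _ = refl
    ... | no  _ = refl

  Hub : Adj V → (Slot (n + 2) → Bool) → Set
  Hub E R = ∀ c x → E apex (ι c x) ≡ R x × E (ι c x) apex ≡ R x

  -- pivots outside R are not adjacent to the apex, so they keep its neighbourhood
  hub-lcSeq : ∀ {E R} (ps : List (Fin n × Slot (n + 2))) → All (λ p → R (proj₂ p) ≡ false) ps →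
              Hub E R → Hub (lcSeq dV E (map (uncurry ι) ps)) R
  hub-lcSeq         []              []         hub = hub
  hub-lcSeq {E} {R} ((c₀ , v) ∷ ps) (Rv ∷ Rvs) hub = hub-lcSeq ps Rvs hub′
    where
    hub′ : Hub (lcE dV E (ι c₀ v)) R
    hub′ c x = trans (proj₁ kept) (proj₁ (hub c x)) , trans (proj₂ kept) (proj₂ (hub c x))
      where kept = lcE-nonneighbour dV E (trans (proj₂ (hub c₀ v)) Rv) (ι c x)

  apex-step : ∀ {E L R} → Hub E R → Blocks E L (λ x y → R x ∧ R y) →
              Blocks (lcE dV E apex) (λ c → complementOn dL R (L c)) (λ _ _ → false)
  inside (apex-step {E} hub B) c =
    complementOn-pullback dL dV {E = E} {S = E apex} (ι-injective c) (inside B c) (λ x → proj₁ (hub c x))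
  across (apex-step {E} {R = R} hub B) {c} {d} c≢d x y
    rewrite across B c≢d x y | proj₁ (hub c x) | proj₁ (hub d y) | eqb-≢ dV (ι-separates c≢d x y)
          | ∧-identityʳ (R y) = xor-same (R x ∧ R y)

  initial-blocks : Blocks E₀ (λ _ → joinE t G H) joinedH
  inside initial-blocks c         = power-same (c ↑ˡ 1)
  across initial-blocks {c} {d} c≢d x y =
    power-distinct (λ e → c≢d (FinP.↑ˡ-injective 1 c d e)) x y

  initial-hub : Hub E₀ isH
  initial-hub c x = power-distinct (apex-separate c) (inj₂ spare₁) x
                  , trans (power-distinct (λ e → apex-separate c (sym e)) x (inj₂ spare₁))
                          (∧-identityʳ (isH x))

  vertexMinor : (opsA opsB : List (Slot (n + 2))) → All (λ v → isH v ≡ false) opsA →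
    (g : TV n → Slot (n + 2)) → Injective _≡_ _≡_ g →
    (∀ x y → TE x y ≡ lcSeq dL (complementOn dL isH (lcSeq dL (joinE t G H) opsA)) opsB (g x) (g y)) →
    HasVertexMinorIsoTo dV (Pow t G H (n + 1) A0001) (nT2 n)
  vertexMinor opsA opsB inG g g-injective local = pivots , f , f-injective , edges
    where
    J : Adj (Slot (n + 2))
    J = joinE t G H

    pivotsA pivotsB pivots : List V
    pivotsA = map (uncurry ι) (rounds opsA)
    pivotsB = map (uncurry ι) (rounds opsB)
    pivots  = pivotsA ++ apex ∷ pivotsB

    Eₐ : Adj V
    Eₐ = lcSeq dV E₀ pivotsA

    -- the pivots opsA in every copy: they lie in G, so they are isolated from the
    -- other copies and from the apex
    afterA : Blocks Eₐ (λ c → lcSeq dL J (pivotsAt c (rounds opsA))) joinedH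
    afterA = blocks-lcSeq (rounds opsA) (rounds-All (All.map (λ v∈G y → cong (_∧ isH y) v∈G) inG))
                          initial-blocks

    hubA : Hub Eₐ isH
    hubA = hub-lcSeq (rounds opsA) (rounds-All inG) initial-hub

    afterB : Blocks (lcSeq dV (lcE dV Eₐ apex) pivotsB)
                    (λ c → lcSeq dL (complementOn dL isH (lcSeq dL J (pivotsAt c (rounds opsA))))
                                    (pivotsAt c (rounds opsB)))
                    (λ _ _ → false)
    afterB = blocks-lcSeq (rounds opsB) (rounds-All (All.universal (λ _ _ → refl) opsB)) (apex-step hubA afterA)

    Local : Adj (Slot (n + 2))
    Local = lcSeq dL (complementOn dL isH (lcSeq dL J opsA)) opsB

    final : Blocks (lcSeq dV E₀ pivots) (λ _ → Local) (λ _ _ → false)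
    final = subst (λ F → Blocks F (λ _ → Local) (λ _ _ → false))
                  (sym (lcSeq-++ dV E₀ pivotsA (apex ∷ pivotsB)))
      (blocks-cong (λ c → cong₂ (λ qs rs → lcSeq dL (complementOn dL isH (lcSeq dL J qs)) rs)
                                (pivotsAt-rounds c opsA) (pivotsAt-rounds c opsB))
                   afterB)

    f : Fin n × TV n → V
    f (c , x) = ι c (g x)

    f-injective : Injective _≡_ _≡_ f
    f-injective {c , x} {d , y} e =
      cong₂ _,_ (FinP.↑ˡ-injective 1 c d (cong proj₁ e)) (g-injective (cong proj₂ e))

    edges : ∀ p q → E (nT2 n) p q ≡ lcSeq dV E₀ pivots (f p) (f q)
    edges (c , x) (d , y) with c ≟ d
    ... | yes refl = trans (local x y) (sym (inside final c (g x) (g y)))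
    ... | no c≢d   = sym (across final c≢d (g x) (g y))

-- The cases K ⊕₌ K, K ⊕₌ K̄ and K ⊕≠ K: after H has been complemented, the local
-- complementations at v_{n} and w_{n+1} of one copy turn the slots embed(T_{2,n})
-- into T_{2,n}.

spareOps : {n : ℕ} → List (Slot (n + 2))
spareOps = inj₁ spare₁ ∷ inj₂ spare₂ ∷ []

viaSpares : JoinType → (F F′ : (m : ℕ) → SimpleGraph (Fin m)) (n : ℕ) → Adj (Slot (n + 2))
viaSpares t F F′ n =
  lcSeq (dSlot (n + 2)) (complementOn (dSlot (n + 2)) isH (joinE t (F (n + 2)) (F′ (n + 2)))) spareOps

viaSpares-spread : (t : JoinType) (F F′ : (m : ℕ) → SimpleGraph (Fin m)) →
  EqualityDefined F → EqualityDefined F′ → {n : ℕ} {i j : Fin n} → i ≢ j →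
  PullsBack (mapSlot (spread i j)) (viaSpares t F F′ n) (viaSpares t F F′ 2)
viaSpares-spread t F F′ eqF eqF′ {n} i≢j =
  lcSeq-pullback (dSlot 4) (dSlot (n + 2))
    {E = complementOn (dSlot (n + 2)) isH (joinE t (F (n + 2)) (F′ (n + 2)))} spread-inj
    (complementOn-pullback (dSlot 4) (dSlot (n + 2)) {E = joinE t (F (n + 2)) (F′ (n + 2))} {S = isH}
      spread-inj (join-pullback t F F′ eqF eqF′ (spread-injective i≢j)) (isH-map _))
    (spareOps {2})
  where
  spread-inj = mapSlot-injective (spread-injective i≢j)

viaSpares-T₂ₙ : {n : ℕ} → 2 ≤ n → (t : JoinType) (F F′ : (m : ℕ) → SimpleGraph (Fin m)) →
  EqualityDefined F → EqualityDefined F′ →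
  (∀ x y → TE x y ≡ viaSpares t F F′ 2 (embed x) (embed y)) →
  ∀ x y → TE x y ≡ viaSpares t F F′ n (embed x) (embed y)
viaSpares-T₂ₙ {n} 2≤n t F F′ eqF eqF′ =
  transfer 2≤n (λ x y → viaSpares t F F′ n (embed x) (embed y))
               (λ x y → viaSpares t F F′ 2 (embed x) (embed y))
    λ i j i≢j x y → trans (cong₂ (viaSpares t F F′ n) (embed-relabel i j x) (embed-relabel i j y))
                          (viaSpares-spread t F F′ eqF eqF′ i≢j (embed x) (embed y))

-- The case K ⊕≠ K̄: the local complementation at v_{n} makes v_{n} adjacent to all
-- v_i and w_i; the local complementations at the pairwise non-adjacent v_0, ..., v_{n-1}
-- then remove the edges v_{n} w_i, and complementing H finishes T_{2,n}.

module _ {m : ℕ} (a : Fin m) where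

  private
    L : Adj (Slot m)
    L = lcE (dSlot m) (joinE ⊕≠ (K m) (coK m)) (inj₁ a)

  pivot-row-a : {p : Fin m} → p ≢ a → L (inj₁ p) (inj₁ a) ≡ true
  pivot-row-a {p} p≢a
    rewrite eqb-≢ _≟_ p≢a | eqb-≢ _≟_ (≢-sym p≢a) | eqb-refl _≟_ a = refl

  pivot-row-G : {p q : Fin m} → p ≢ a → q ≢ a → L (inj₁ p) (inj₁ q) ≡ false
  pivot-row-G {p} {q} p≢a q≢a
    rewrite eqb-≢ _≟_ (≢-sym p≢a) | eqb-≢ _≟_ (≢-sym q≢a)
          | eqb-injective _≟_ (dSlot m) SumP.inj₁-injective p q = xor-same (not (eqb _≟_ p q))

  pivot-row-H : {p q : Fin m} → p ≢ a → q ≢ a → L (inj₁ p) (inj₂ q) ≡ eqb _≟_ p q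
  pivot-row-H {p} {q} p≢a q≢a rewrite eqb-≢ _≟_ (≢-sym p≢a) | eqb-≢ _≟_ (≢-sym q≢a) =
    trans (xor-comm (not (eqb _≟_ p q)) true) (trans (Bool.true-xor _) (Bool.not-involutive _))

afterSpare : (n : ℕ) → Adj (Slot (n + 2))
afterSpare n = lcE (dSlot (n + 2)) (joinE ⊕≠ (K (n + 2)) (coK (n + 2))) (inj₁ spare₁)

branchPivots : {n : ℕ} → List (Slot (n + 2))
branchPivots = tabulate (λ c → inj₁ (base c))

OffSpare : {n : ℕ} → Slot (n + 2) → Set
OffSpare (inj₁ p) = p ≢ spare₁
OffSpare (inj₂ _) = ⊥

afterSpare-independent : {n : ℕ} → Independent (afterSpare n) (OffSpare {n})
afterSpare-independent {u = inj₁ p} {inj₁ q} p≢a q≢a = pivot-row-G spare₁ p≢a q≢a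

base≢spare : {n : ℕ} (c : Fin n) → base c ≢ spare₁
base≢spare c = ↑ˡ≢↑ʳ c zero

star : {n : ℕ} → Fin n → TV n → Bool
star c centre   = true
star c (sub _)  = false
star c (leaf i) = eqb _≟_ c i

pivot-star : {n : ℕ} (c : Fin n) (z : TV n) → afterSpare n (inj₁ (base c)) (embed z) ≡ star c z
pivot-star c centre   = pivot-row-a spare₁ (base≢spare c)
pivot-star c (sub i)  = pivot-row-G spare₁ (base≢spare c) (base≢spare i)
pivot-star c (leaf i) = trans (pivot-row-H spare₁ (base≢spare c) (base≢spare i))
                              (eqb-injective _≟_ _≟_ base-injective c i)

spoke : {k : ℕ} → TV k → TV k → Bool
spoke centre   (leaf _) = true
spoke (leaf _) centre   = true
spoke _        _        = false

spoke-relabel : {k n : ℕ} (τ : Fin k → Fin n) (x y : TV k) →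
                spoke (relabel τ x) (relabel τ y) ≡ spoke x y
spoke-relabel τ centre   centre   = refl
spoke-relabel τ centre   (sub _)  = refl
spoke-relabel τ centre   (leaf _) = refl
spoke-relabel τ (sub _)  _        = refl
spoke-relabel τ (leaf _) centre   = refl
spoke-relabel τ (leaf _) (sub _)  = refl
spoke-relabel τ (leaf _) (leaf _) = refl

-- the spoke centre–leaf i is flipped by the pivot v_i alone; nothing else is flipped
spoke-sum : {n : ℕ} (x y : TV n) →
  xorSum (λ c → star c x ∧ (star c y ∧ not (eqb (dSlot (n + 2)) (embed x) (embed y)))) ≡ spoke x y
spoke-sum {n} centre centre
  rewrite eqb-refl (dSlot (n + 2)) (inj₁ (spare₁ {n})) = xorSum-false {k = n} _ (λ _ → refl)
spoke-sum {n} centre   (sub j)  = xorSum-false {k = n} _ (λ _ → refl)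
spoke-sum {n} centre   (leaf j) =
  trans (xorSum-single {k = n} _ j (λ c c≢j → cong (_∧ true) (eqb-≢ _≟_ c≢j))) (cong (_∧ true) (eqb-refl _≟_ j))
spoke-sum {n} (sub i)  y        = xorSum-false {k = n} _ (λ _ → refl)
spoke-sum {n} (leaf i) centre   =
  trans (xorSum-single {k = n} _ i (λ c c≢i → cong (_∧ true) (eqb-≢ _≟_ c≢i))) (cong (_∧ true) (eqb-refl _≟_ i))
spoke-sum {n} (leaf i) (sub j)  = xorSum-false {k = n} _ (λ c → ∧-zeroʳ (eqb _≟_ c i))
spoke-sum {n} (leaf i) (leaf j) = xorSum-false {k = n} _ (noTwoLeaves i j)
  where
  noTwoLeaves : ∀ {n} (i j c : Fin n) →
    eqb _≟_ c i ∧ (eqb _≟_ c j ∧ not (eqb (dSlot (n + 2)) (embed (leaf i)) (embed (leaf j))))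
      ≡ false
  noTwoLeaves i j c with c ≟ i | c ≟ j
  ... | no _     | _        = refl
  ... | yes _    | no _     = refl
  ... | yes refl | yes refl = cong not (eqb-refl (dSlot _) (embed (leaf c)))

flips-spoke : {n : ℕ} (x y : TV n) →
  flips (dSlot (n + 2)) (afterSpare n) branchPivots (embed x) (embed y) ≡ spoke x y
flips-spoke x y = trans
  (cong (foldr _xor_ false) (trans (map-tabulate _ _)
    (tabulate-cong (λ c → cong₂ _∧_ (pivot-star c x) (cong (_∧ _) (pivot-star c y))))))
  (spoke-sum x y)

afterBranches : (n : ℕ) → Adj (Slot (n + 2))
afterBranches n = complementOn (dSlot (n + 2)) isH (lcSeq (dSlot (n + 2)) (afterSpare n) branchPivots)

-- by independence the branch pivots only add their flips
afterBranches-split : {n : ℕ} (p q : Slot (n + 2)) →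
  afterBranches n p q ≡ complementOn (dSlot (n + 2)) isH (afterSpare n) p q
                          xor flips (dSlot (n + 2)) (afterSpare n) branchPivots p q
afterBranches-split {n} p q = begin
  lcSeq d L₁ branchPivots p q xor cl                 ≡⟨ cong (_xor cl) independent ⟩
  (L₁ p q xor flips d L₁ branchPivots p q) xor cl    ≡⟨ xor-assoc (L₁ p q) _ cl ⟩
  L₁ p q xor (flips d L₁ branchPivots p q xor cl)    ≡⟨ cong (L₁ p q xor_) (xor-comm _ cl) ⟩
  L₁ p q xor (cl xor flips d L₁ branchPivots p q)    ≡⟨ sym (xor-assoc (L₁ p q) cl _) ⟩
  (L₁ p q xor cl) xor flips d L₁ branchPivots p q    ∎
  where
  open ≡-Reasoning
  d = dSlot (n + 2)
  L₁ = afterSpare n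
  cl = clique d isH p q
  independent : lcSeq d L₁ branchPivots p q ≡ L₁ p q xor flips d L₁ branchPivots p q
  independent = lcSeq-independent d {E = L₁} {S = OffSpare {n}} afterSpare-independent
                                  (tabulate⁺ (base≢spare {n})) p q

afterSpare-spread : {n : ℕ} {i j : Fin n} → i ≢ j →
  PullsBack (mapSlot (spread i j)) (complementOn (dSlot (n + 2)) isH (afterSpare n))
                                   (complementOn (dSlot 4) isH (afterSpare 2))
afterSpare-spread {n} i≢j =
  complementOn-pullback (dSlot 4) (dSlot (n + 2)) {E = afterSpare n} {S = isH} spread-inj
    (lcSeq-pullback (dSlot 4) (dSlot (n + 2)) {E = joinE ⊕≠ (K (n + 2)) (coK (n + 2))} spread-inj
      (join-pullback ⊕≠ K coK K-equalityDefined coK-equalityDefined (spread-injective i≢j))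
      (inj₁ (spare₁ {2}) ∷ []))
    (isH-map _)
  where
  spread-inj = mapSlot-injective (spread-injective i≢j)

withSpokes : (k : ℕ) → TV k → TV k → Bool
withSpokes k x y = complementOn (dSlot (k + 2)) isH (afterSpare k) (embed x) (embed y) xor spoke x y

withSpokes-relabel : {n : ℕ} (i j : Fin n) → i ≢ j → ∀ x y →
  withSpokes n (relabel (pair i j) x) (relabel (pair i j) y) ≡ withSpokes 2 x y
withSpokes-relabel {n} i j i≢j x y = cong₂ _xor_
  (trans (cong₂ (complementOn (dSlot (n + 2)) isH (afterSpare n)) (embed-relabel i j x) (embed-relabel i j y))
         (afterSpare-spread i≢j (embed x) (embed y)))
  (spoke-relabel (pair i j) x y)

afterBranches-spokes : {n : ℕ} (x y : TV n) → afterBranches n (embed x) (embed y) ≡ withSpokes n x y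
afterBranches-spokes {n} x y = trans (afterBranches-split (embed x) (embed y))
  (cong (complementOn (dSlot (n + 2)) isH (afterSpare n) (embed x) (embed y) xor_) (flips-spoke x y))

-- the construction for K ⊕≠ K̄ yields T_{2,n}: the adjacency with spokes restricts
-- to two branches, and for n = 2 it is checked by evaluation
afterBranches-T₂ₙ : {n : ℕ} → 2 ≤ n → ∀ x y → TE x y ≡ afterBranches n (embed x) (embed y)
afterBranches-T₂ₙ {n} 2≤n x y =
  trans (transfer 2≤n (withSpokes n) (withSpokes 2) withSpokes-relabel (byEvaluation (withSpokes 2)) x y)
        (sym (afterBranches-spokes x y))

lemma4p12 : (n : ℕ) → 2 ≤ n →
    HasVertexMinorIsoTo (PowV-dec (n + 1) (n + 2)) (Pow ⊕₌ (K (n + 2)) (K (n + 2)) (n + 1) A0001) (nT2 n)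
    × HasVertexMinorIsoTo (PowV-dec (n + 1) (n + 2)) (Pow ⊕₌ (K (n + 2)) (coK (n + 2)) (n + 1) A0001) (nT2 n)
    × HasVertexMinorIsoTo (PowV-dec (n + 1) (n + 2)) (Pow ⊕≠ (K (n + 2)) (K (n + 2)) (n + 1) A0001) (nT2 n)
    × HasVertexMinorIsoTo (PowV-dec (n + 1) (n + 2)) (Pow ⊕≠ (K (n + 2)) (coK (n + 2)) (n + 1) A0001) (nT2 n)
lemma4p12 n 2≤n =
    viaSpares-minor ⊕₌ K K-equalityDefined (byEvaluation _)
  , viaSpares-minor ⊕₌ coK coK-equalityDefined (byEvaluation _)
  , viaSpares-minor ⊕≠ K K-equalityDefined (byEvaluation _)
  , PowerGraph.vertexMinor ⊕≠ (K (n + 2)) (coK (n + 2)) (inj₁ spare₁ ∷ branchPivots) []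
      (refl ∷ tabulate⁺ (λ _ → refl)) embed embed-injective (afterBranches-T₂ₙ 2≤n)
  where
  viaSpares-minor : (t : JoinType) (F : (m : ℕ) → SimpleGraph (Fin m)) → EqualityDefined F →
    (∀ x y → TE x y ≡ viaSpares t K F 2 (embed x) (embed y)) →
    HasVertexMinorIsoTo (PowV-dec (n + 1) (n + 2)) (Pow t (K (n + 2)) (F (n + 2)) (n + 1) A0001) (nT2 n)
  viaSpares-minor t F eqF onT₂₂ =
    PowerGraph.vertexMinor t (K (n + 2)) (F (n + 2)) [] spareOps [] embed embed-injective
      (viaSpares-T₂ₙ 2≤n t K F K-equalityDefined eqF onT₂₂)
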